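{- For all $m,n\in\mathbb{N}$, $$T(n,m)=u_{m+1}^{T}A_{m+1}^{\,n}\,v_{m+1,1}.$$ (For $n\ge 1$ the right-hand side also equals $u_{m+1}^TA_{m+1}^{n-1}u_{m+1}$.)
   Context: $T(n,m)$, $n,m\in\mathbb{N}$, is the array defined by $T(n,0)=1$ for all $n\in\mathbb{N}$ and, for $m\ge 1$, $T(n,m)=T(n,m-1)+\sum_{k=0}^{\lfloor (n-1)/2\rfloor}T(2k,m-1)\,T(n-1-2k,m)$ (the sum is empty when $n=0$). For a positive integer $m$, $A_m$ is the $m\times m$ matrix whose $(i,j)$ entry is $1$ if $i+j\le m+1$ and $0$ otherwise; $u_m=(1,\dots,1)^T\in\mathbb{R}^m$; and $v_{m,1}$ is the first standard unit column vector of $\mathbb{R}^m$. -}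

module Defs where

open import Data.Nat using (ℕ; zero; suc; _+_; _*_; _<ᵇ_; _∸_)
open import Data.Bool using (Bool; true; false; if_then_else_)
open import Data.Fin using (Fin; toℕ)
import Data.Fin as Fin
open import Data.Vec using (Vec; []; _∷_)

-- T(n,0) = 1;  T(n,m) = T(n,m-1) + Σ_{k=0}^{⌊(n-1)/2⌋} T(2k,m-1) T(n-1-2k,m).
-- For fixed m ≥ 1 we compute the values T(0,m),…,T(n,m) by course-of-values
-- recursion on n, given the previous column  prev = T(·,m-1).

-- Σ_{k : 2k ≤ j} prev(2k) * cur(j - 2k), where  cur i = T(i,m)  for i ≤ j.
-- 'evenConv prev cur j i' sums over the indices  i' ∈ {0,…,i}  with  i' even.
evenConv : (ℕ → ℕ) → (ℕ → ℕ) → ℕ → ℕ → ℕ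
evenConv prev cur j zero    = prev 0 * cur j
evenConv prev cur j (suc i) =
  evenConv prev cur j i + (if isEven (suc i) then prev (suc i) * cur (j ∸ suc i) else 0)
  where
  isEven : ℕ → Bool
  isEven zero          = true
  isEven (suc zero)    = false
  isEven (suc (suc k)) = isEven k

-- list of values T(n,m), T(n-1,m), …, T(0,m)  (most recent first)
colRev : (ℕ → ℕ) → (n : ℕ) → Vec ℕ (suc n)
colRev prev zero    = prev 0 ∷ []       -- T(0,m) = T(0,m-1) (empty sum)
colRev prev (suc n) = new ∷ vs
  where
  vs : Vec ℕ (suc n)
  vs = colRev prev n
  -- cur i = T(i,m) for i ≤ n
  cur : ℕ → ℕ
  cur i = lookupℕ vs (n ∸ i)
    where
    lookupℕ : ∀ {k} → Vec ℕ k → ℕ → ℕ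
    lookupℕ []       _       = 0
    lookupℕ (x ∷ xs) zero    = x
    lookupℕ (x ∷ xs) (suc i) = lookupℕ xs i
  -- T(n+1,m) = T(n+1,m-1) + Σ_{2k ≤ n} T(2k,m-1) T(n-2k,m)
  new : ℕ
  new = prev (suc n) + evenConv prev cur n n

T : ℕ → ℕ → ℕ
T n zero    = 1
T n (suc m) = Data.Vec.head (colRev (λ i → T i m) n)

-- Matrices over ℕ as functions  Fin k → Fin k → ℕ  (0-based indices).

Matrix : ℕ → Set
Matrix k = Fin k → Fin k → ℕ

ΣFin : ∀ {k} → (Fin k → ℕ) → ℕ
ΣFin {zero}  f = 0
ΣFin {suc k} f = f Fin.zero + ΣFin (λ i → f (Fin.suc i))

_⊗_ : ∀ {k} → Matrix k → Matrix k → Matrix k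
(M ⊗ N) i j = ΣFin (λ l → M i l * N l j)

idM : ∀ {k} → Matrix k
idM i j = if toℕ i Data.Nat.≡ᵇ toℕ j then 1 else 0

_^M_ : ∀ {k} → Matrix k → ℕ → Matrix k
M ^M zero  = idM
M ^M suc n = M ⊗ (M ^M n)

-- A_k : (i,j) entry (1-based) is 1 iff i + j ≤ k + 1;
-- with 0-based indices i', j' this is i' + j' < k.
A : (k : ℕ) → Matrix k
A k i j = if (toℕ i + toℕ j) <ᵇ k then 1 else 0

-- u_k^T M v_{k,1} = Σ_i M i 0   (v_{k,1} the first standard unit vector;
-- requires k ≥ 1, so stated for k = suc m)
-- bilinear form  x^T M y
bil : ∀ {k} → (Fin k → ℕ) → Matrix k → (Fin k → ℕ) → ℕ
bil x M y = ΣFin (λ i → ΣFin (λ j → x i * M i j * y j))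

u : (k : ℕ) → Fin k → ℕ
u k i = 1

v1 : (m : ℕ) → Fin (suc m) → ℕ
v1 m i = if toℕ i Data.Nat.≡ᵇ 0 then 1 else 0

module Submission where

-- Let uA k n s be entry s of the row vector u_kᵀ A_kⁿ, so the right-hand side is
-- uA (m+1) n 0; multiplying a row vector by A_k on the right sums its first k − s
-- entries. Comparing the rows of A_(k+1)ⁿ and A_kⁿ by a simultaneous induction on n
-- for even and odd column shifts gives
--   uA (k+1) n s     = uA k n s + Σ_{j<n} [j even] uA k j s · uA (k+1) (n−1−j) 0,
--   uA (k+1) n (s+1) = uA k n s + Σ_{j<n} [j odd]  uA k j s · uA (k+1) (n−1−j) 0.
-- At s = 0 the first identity is the defining recurrence of T(·, m+1) in terms of
-- T(·, m); that recurrence determines the column, so induction on m finishes.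

open import Defs
open import Data.Nat using (ℕ; zero; suc; _+_; _*_; _∸_; _≤_; _<_; _<ᵇ_; z<s)
open import Data.Nat.Properties
  using (+-*-semiring; +-commutativeSemigroup; +-identityʳ; *-identityʳ; *-zeroʳ; *-assoc;
         +-∸-assoc; m∸n≤m; m∸n+n≡m; ∸-monoʳ-<; <⇒≤; <-≤-trans; ≤-pred)
open import Data.Nat.Induction using (<-rec)
open import Data.Bool using (Bool; if_then_else_)
open import Data.Fin as Fin using (Fin; zero; suc; toℕ)
open import Data.Fin.Properties using (toℕ<n; toℕ-inject₁; toℕ-fromℕ)
open import Data.Vec using (Vec; head)
open import Function using (_∘_)
open import Relation.Binary.PropositionalEquality
open ≡-Reasoning
open import Algebra.Properties.Semiring.Sum +-*-semiring
  using (sum; sum-cong-≗; sum-init-last;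
         ∑-distrib-+; ∑-comm; *-distribˡ-sum; *-distribʳ-sum)
open import Algebra.Properties.CommutativeSemigroup +-commutativeSemigroup using (x∙yz≈y∙xz)

ΣFin≡sum : ∀ {k} (f : Fin k → ℕ) → ΣFin f ≡ sum f
ΣFin≡sum {zero}  f = refl
ΣFin≡sum {suc k} f = cong (f zero +_) (ΣFin≡sum (f ∘ suc))

ΣFin-cong : ∀ {k} {f g : Fin k → ℕ} → (∀ i → f i ≡ g i) → ΣFin f ≡ ΣFin g
ΣFin-cong {zero}  f≗g = refl
ΣFin-cong {suc k} f≗g = cong₂ _+_ (f≗g zero) (ΣFin-cong (f≗g ∘ suc))

ΣFin-zero : ∀ k → ΣFin {k} (λ _ → 0) ≡ 0
ΣFin-zero zero    = refl
ΣFin-zero (suc k) = ΣFin-zero k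

∑-snoc : ∀ n (f : ℕ → ℕ) → sum {suc n} (f ∘ toℕ) ≡ sum {n} (f ∘ toℕ) + f n
∑-snoc n f = begin
  sum {suc n} (f ∘ toℕ)
    ≡⟨ sum-init-last (f ∘ toℕ) ⟩
  sum {n} (f ∘ toℕ ∘ Fin.inject₁) + f (toℕ (Fin.fromℕ n))
    ≡⟨ cong₂ _+_ (sum-cong-≗ {n} (cong f ∘ toℕ-inject₁)) (cong f (toℕ-fromℕ n)) ⟩
  sum {n} (f ∘ toℕ) + f n ∎

*-distrib-sum : ∀ {n} a b (f : Fin n → ℕ) → a * sum f * b ≡ sum λ t → a * f t * b
*-distrib-sum a b f =
  trans (cong (_* b) (*-distribˡ-sum a f)) (*-distribʳ-sum b (λ t → a * f t))

infixl 7 _ᵀ*_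

_ᵀ*_ : ∀ {k} → (Fin k → ℕ) → Matrix k → Fin k → ℕ
(x ᵀ* M) j = ΣFin λ i → x i * M i j

ᵀ*-cong : ∀ {k} {x y : Fin k → ℕ} (M : Matrix k) → (∀ i → x i ≡ y i) →
          ∀ j → (x ᵀ* M) j ≡ (y ᵀ* M) j
ᵀ*-cong M x≗y j = ΣFin-cong λ i → cong (_* M i j) (x≗y i)

ᵀ*-⊗ : ∀ {k} (x : Fin k → ℕ) (M N : Matrix k) j → (x ᵀ* (M ⊗ N)) j ≡ ((x ᵀ* M) ᵀ* N) j
ᵀ*-⊗ x M N j = begin
  ΣFin (λ i → x i * ΣFin (λ l → M i l * N l j))
    ≡⟨ ΣFin≡sum (λ i → x i * ΣFin (λ l → M i l * N l j)) ⟩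
  sum (λ i → x i * ΣFin (λ l → M i l * N l j))
    ≡⟨ sum-cong-≗ (λ i → cong (x i *_) (ΣFin≡sum λ l → M i l * N l j)) ⟩
  sum (λ i → x i * sum λ l → M i l * N l j)
    ≡⟨ sum-cong-≗ (λ i → *-distribˡ-sum (x i) λ l → M i l * N l j) ⟩
  sum (λ i → sum λ l → x i * (M i l * N l j))
    ≡⟨ ∑-comm (λ i l → x i * (M i l * N l j)) ⟩
  sum (λ l → sum λ i → x i * (M i l * N l j))
    ≡⟨ sum-cong-≗ (λ l → sum-cong-≗ λ i → sym (*-assoc (x i) (M i l) (N l j))) ⟩
  sum (λ l → sum λ i → x i * M i l * N l j)
    ≡⟨ sum-cong-≗ (λ l → sym (*-distribʳ-sum (N l j) λ i → x i * M i l)) ⟩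
  sum (λ l → sum (λ i → x i * M i l) * N l j)
    ≡⟨ sum-cong-≗ (λ l → cong (_* N l j) (sym (ΣFin≡sum λ i → x i * M i l))) ⟩
  sum (λ l → (x ᵀ* M) l * N l j)
    ≡⟨ sym (ΣFin≡sum λ l → (x ᵀ* M) l * N l j) ⟩
  ((x ᵀ* M) ᵀ* N) j ∎

ᵀ*-idM : ∀ {k} (x : Fin k → ℕ) j → (x ᵀ* idM) j ≡ x j
ᵀ*-idM {suc k} x zero = begin
  x zero * 1 + ΣFin (λ i → x (suc i) * 0)
    ≡⟨ cong₂ _+_ (*-identityʳ _) (trans (ΣFin-cong (*-zeroʳ ∘ x ∘ suc)) (ΣFin-zero k)) ⟩
  x zero + 0
    ≡⟨ +-identityʳ _ ⟩
  x zero ∎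
ᵀ*-idM x (suc j) = cong₂ _+_ (*-zeroʳ (x zero)) (ᵀ*-idM (x ∘ suc) j)

ᵀ*-^M-suc : ∀ {k} (M : Matrix k) n (x : Fin k → ℕ) j →
            (x ᵀ* (M ^M suc n)) j ≡ ((x ᵀ* (M ^M n)) ᵀ* M) j
ᵀ*-^M-suc M zero x j = begin
  (x ᵀ* (M ⊗ idM)) j     ≡⟨ ᵀ*-⊗ x M idM j ⟩
  ((x ᵀ* M) ᵀ* idM) j    ≡⟨ ᵀ*-idM (x ᵀ* M) j ⟩
  (x ᵀ* M) j             ≡⟨ ᵀ*-cong M (sym ∘ ᵀ*-idM x) j ⟩
  ((x ᵀ* idM) ᵀ* M) j    ∎
ᵀ*-^M-suc M (suc n) x j = begin
  (x ᵀ* (M ⊗ (M ^M suc n))) j       ≡⟨ ᵀ*-⊗ x M (M ^M suc n) j ⟩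
  ((x ᵀ* M) ᵀ* (M ^M suc n)) j      ≡⟨ ᵀ*-^M-suc M n (x ᵀ* M) j ⟩
  (((x ᵀ* M) ᵀ* (M ^M n)) ᵀ* M) j   ≡⟨ ᵀ*-cong M (sym ∘ ᵀ*-⊗ x M (M ^M n)) j ⟩
  ((x ᵀ* (M ^M suc n)) ᵀ* M) j      ∎

bil-v1 : ∀ {m} (x : Fin (suc m) → ℕ) (M : Matrix (suc m)) → bil x M (v1 m) ≡ (x ᵀ* M) zero
bil-v1 {m} x M = ΣFin-cong λ i → begin
  x i * M i zero * 1 + ΣFin (λ j → x i * M i (suc j) * 0)
    ≡⟨ cong₂ _+_ (*-identityʳ _)
                 (trans (ΣFin-cong λ j → *-zeroʳ (x i * M i (suc j))) (ΣFin-zero m)) ⟩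
  x i * M i zero + 0
    ≡⟨ +-identityʳ _ ⟩
  x i * M i zero ∎

mulA : ℕ → (ℕ → ℕ) → ℕ → ℕ
mulA k g s = sum {k ∸ s} (g ∘ toℕ)

uA : ℕ → ℕ → ℕ → ℕ
uA k zero    s = 1
uA k (suc n) s = mulA k (uA k n) s

mulA-suc : ∀ k l (g : ℕ → ℕ) →
           mulA (suc k) g l ≡ g 0 * (if l <ᵇ suc k then 1 else 0) + mulA k (g ∘ suc) l
mulA-suc k       zero          g = cong (_+ mulA k (g ∘ suc) 0) (sym (*-identityʳ (g 0)))
mulA-suc zero    (suc zero)    g = sym (cong (_+ 0) (*-zeroʳ (g 0)))
mulA-suc zero    (suc (suc l)) g = sym (cong (_+ 0) (*-zeroʳ (g 0)))
mulA-suc (suc k) (suc l)       g = mulA-suc k l g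

mulA-peel : ∀ {k l} (g : ℕ → ℕ) → l ≤ k → mulA (suc k) g l ≡ g 0 + mulA k (g ∘ suc) l
mulA-peel g l≤k = cong (λ r → sum {r} (g ∘ toℕ)) (+-∸-assoc 1 l≤k)

∑-indicator : ∀ k l (g : ℕ → ℕ) →
              sum {k} (λ t → g (toℕ t) * (if toℕ t + l <ᵇ k then 1 else 0)) ≡ mulA k g l
∑-indicator zero    zero    g = refl
∑-indicator zero    (suc l) g = refl
∑-indicator (suc k) l       g =
  trans (cong (g 0 * (if l <ᵇ suc k then 1 else 0) +_) (∑-indicator k l (g ∘ suc)))
        (sym (mulA-suc k l g))

ᵀ*-A : ∀ k (g : ℕ → ℕ) s → ((g ∘ toℕ) ᵀ* A k) s ≡ mulA k g (toℕ s)
ᵀ*-A k g s = trans (ΣFin≡sum λ t → g (toℕ t) * A k t s) (∑-indicator k (toℕ s) g)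

u-A^n : ∀ k n s → (u k ᵀ* (A k ^M n)) s ≡ uA k n (toℕ s)
u-A^n k zero    s = ᵀ*-idM (u k) s
u-A^n k (suc n) s = begin
  (u k ᵀ* (A k ^M suc n)) s           ≡⟨ ᵀ*-^M-suc (A k) n (u k) s ⟩
  ((u k ᵀ* (A k ^M n)) ᵀ* A k) s      ≡⟨ ᵀ*-cong (A k) (u-A^n k n) s ⟩
  ((uA k n ∘ toℕ) ᵀ* A k) s           ≡⟨ ᵀ*-A k (uA k n) s ⟩
  uA k (suc n) (toℕ s)                ∎

mutual
  χ-even : ℕ → ℕ
  χ-even zero    = 1
  χ-even (suc j) = χ-odd j

  χ-odd : ℕ → ℕ
  χ-odd zero    = 0
  χ-odd (suc j) = χ-even j

conv : (ℕ → ℕ) → (ℕ → ℕ) → (ℕ → ℕ) → ℕ → ℕ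
conv w f g n = sum {n} λ j → w (toℕ j) * f (toℕ j) * g (n ∸ suc (toℕ j))

conv-cong : ∀ (w : ℕ → ℕ) {f f′ g g′ : ℕ → ℕ} n →
            (∀ j → j < n → f j ≡ f′ j) → (∀ j → j < n → g j ≡ g′ j) →
            conv w f g n ≡ conv w f′ g′ n
conv-cong w n f≡f′ g≡g′ = sum-cong-≗ {n} λ j →
  cong₂ _*_ (cong (w (toℕ j) *_) (f≡f′ (toℕ j) (toℕ<n j)))
            (g≡g′ (n ∸ suc (toℕ j)) (∸-monoʳ-< z<s (toℕ<n j)))

∑-conv : ∀ {a} (w : ℕ → ℕ) (F : ℕ → ℕ → ℕ) g n →
         sum {a} (λ t → conv w (λ j → F j (toℕ t)) g n) ≡
         conv w (λ j → sum {a} (F j ∘ toℕ)) g n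
∑-conv {a} w F g n = begin
  sum {a} (λ t → sum {n} λ j → w (toℕ j) * F (toℕ j) (toℕ t) * g (n ∸ suc (toℕ j)))
    ≡⟨ ∑-comm {a} {n} (λ t j → w (toℕ j) * F (toℕ j) (toℕ t) * g (n ∸ suc (toℕ j))) ⟩
  sum {n} (λ j → sum {a} λ t → w (toℕ j) * F (toℕ j) (toℕ t) * g (n ∸ suc (toℕ j)))
    ≡⟨ sum-cong-≗ {n} (λ j → sym (*-distrib-sum {a} (w (toℕ j)) (g (n ∸ suc (toℕ j)))
                                                              (F (toℕ j) ∘ toℕ))) ⟩
  conv w (λ j → sum {a} (F j ∘ toℕ)) g n ∎

module _ (k : ℕ) where

  private
    R : ℕ → ℕ
    R r = uA (suc k) r 0

    below : ∀ s (t : Fin (k ∸ s)) → toℕ t < k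
    below s t = <-≤-trans (toℕ<n t) (m∸n≤m k s)

  ∑-uA+conv : ∀ w n s →
            sum {k ∸ s} (λ t → uA k n (toℕ t) + conv w (λ j → uA k j (toℕ t)) R n) ≡
            uA k (suc n) s + conv w (λ j → uA k (suc j) s) R n
  ∑-uA+conv w n s = trans (∑-distrib-+ {k ∸ s} (uA k n ∘ toℕ) _)
                        (cong (uA k (suc n) s +_) (∑-conv {k ∸ s} w (uA k) R n))

  mutual
    uA-suc-even : ∀ n s → s < k →
                  uA (suc k) n s ≡ uA k n s + conv χ-even (λ j → uA k j s) R n
    uA-suc-even zero    _ _   = refl
    uA-suc-even (suc n) s s<k = begin
      mulA (suc k) (uA (suc k) n) s
        ≡⟨ mulA-peel (uA (suc k) n) (<⇒≤ s<k) ⟩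
      R n + sum {k ∸ s} (λ t → uA (suc k) n (suc (toℕ t)))
        ≡⟨ cong (R n +_) (sum-cong-≗ {k ∸ s} λ t → uA-suc-odd n (toℕ t) (below s t)) ⟩
      R n + sum {k ∸ s} (λ t → uA k n (toℕ t) + conv χ-odd (λ j → uA k j (toℕ t)) R n)
        ≡⟨ cong (R n +_) (∑-uA+conv χ-odd n s) ⟩
      R n + (uA k (suc n) s + conv χ-odd (λ j → uA k (suc j) s) R n)
        ≡⟨ x∙yz≈y∙xz (R n) (uA k (suc n) s) oddPart ⟩
      uA k (suc n) s + (R n + oddPart)
        ≡⟨ cong (λ r → uA k (suc n) s + (r + oddPart)) (sym (+-identityʳ (R n))) ⟩
      uA k (suc n) s + conv χ-even (λ j → uA k j s) R (suc n) ∎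
      where
      oddPart : ℕ
      oddPart = conv χ-odd (λ j → uA k (suc j) s) R n

    uA-suc-odd : ∀ n s → s < k →
                 uA (suc k) n (suc s) ≡ uA k n s + conv χ-odd (λ j → uA k j s) R n
    uA-suc-odd zero    _ _   = refl
    uA-suc-odd (suc n) s s<k = begin
      sum {k ∸ s} (λ t → uA (suc k) n (toℕ t))
        ≡⟨ sum-cong-≗ {k ∸ s} (λ t → uA-suc-even n (toℕ t) (below s t)) ⟩
      sum {k ∸ s} (λ t → uA k n (toℕ t) + conv χ-even (λ j → uA k j (toℕ t)) R n)
        ≡⟨ ∑-uA+conv χ-even n s ⟩
      uA k (suc n) s + conv χ-odd (λ j → uA k j s) R (suc n) ∎

  uA-suc-recurrence : ∀ n → 0 < k →
                      R (suc n) ≡ uA k (suc n) 0 + conv χ-even (λ j → uA k j 0) R (suc n)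
  uA-suc-recurrence n 0<k = uA-suc-even (suc n) 0 0<k

-- The helpers isEven, cur and lookupℕ of Defs live in where blocks and cannot be
-- named; each is bound to a metavariable that unification solves with the
-- corresponding local function (the with-abstractions make the problems patterns).
-- Their leading arguments are the variables of the enclosing clause, which the
-- helpers ignore.
mutual
  curᴰ : (ℕ → ℕ) → ℕ → ℕ → ℕ
  curᴰ = _

  head-colRev-suc : ∀ prev n →
                    head (colRev prev (suc n)) ≡ prev (suc n) + evenConv prev (curᴰ prev n) n n
  head-colRev-suc prev n = refl

mutual
  lookupᴰ : (ℕ → ℕ) → ℕ → ℕ → ∀ {k} → Vec ℕ k → ℕ → ℕ
  lookupᴰ = _

  curᴰ-lookup : ∀ prev n i → curᴰ prev n i ≡ lookupᴰ prev n i (colRev prev n) (n ∸ i)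
  curᴰ-lookup prev n i with suc n | colRev prev n | n ∸ i
  ... | _ | _ | _ = refl

mutual
  isEvenᴰ : (ℕ → ℕ) → (ℕ → ℕ) → ℕ → ℕ → ℕ → Bool
  isEvenᴰ = _

  evenConv-suc : ∀ p c j i → evenConv p c j (suc i) ≡
                 evenConv p c j i + (if isEvenᴰ p c j i (suc i) then p (suc i) * c (j ∸ suc i) else 0)
  evenConv-suc p c j i with suc i
  ... | _ = refl

lookup-colRev : ∀ prev a b c d t → lookupᴰ a b c (colRev prev (d + t)) d ≡ head (colRev prev t)
lookup-colRev prev a b c zero    zero    = refl
lookup-colRev prev a b c zero    (suc t) = refl
lookup-colRev prev a b c (suc d) t       = lookup-colRev prev a b c d t

curᴰ≡head-colRev : ∀ prev n t → t ≤ n → curᴰ prev n t ≡ head (colRev prev t)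
curᴰ≡head-colRev prev n t t≤n = begin
  curᴰ prev n t
    ≡⟨ curᴰ-lookup prev n t ⟩
  lookupᴰ prev n t (colRev prev n) (n ∸ t)
    ≡⟨ cong (λ r → lookupᴰ prev n t (colRev prev r) (n ∸ t)) (sym (m∸n+n≡m t≤n)) ⟩
  lookupᴰ prev n t (colRev prev (n ∸ t + t)) (n ∸ t)
    ≡⟨ lookup-colRev prev prev n t (n ∸ t) t ⟩
  head (colRev prev t) ∎

if-isEvenᴰ : ∀ p c j i x X → (if isEvenᴰ p c j i x then X else 0) ≡ χ-even x * X
if-isEvenᴰ p c j i zero          X = sym (+-identityʳ X)
if-isEvenᴰ p c j i (suc zero)    X = refl
if-isEvenᴰ p c j i (suc (suc x)) X = if-isEvenᴰ p c j i x X

evenConv≡sum : ∀ p c j i →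
               evenConv p c j i ≡ sum {suc i} λ t → χ-even (toℕ t) * p (toℕ t) * c (j ∸ toℕ t)
evenConv≡sum p c j zero    = sym (trans (+-identityʳ _) (cong (_* c j) (+-identityʳ (p 0))))
evenConv≡sum p c j (suc i) = begin
  evenConv p c j (suc i)
    ≡⟨ evenConv-suc p c j i ⟩
  evenConv p c j i + (if isEvenᴰ p c j i (suc i) then p (suc i) * c (j ∸ suc i) else 0)
    ≡⟨ cong₂ _+_ (evenConv≡sum p c j i) (if-isEvenᴰ p c j i (suc i) _) ⟩
  sum {suc i} (term ∘ toℕ) + χ-even (suc i) * (p (suc i) * c (j ∸ suc i))
    ≡⟨ cong (sum {suc i} (term ∘ toℕ) +_) (sym (*-assoc (χ-even (suc i)) _ _)) ⟩
  sum {suc i} (term ∘ toℕ) + term (suc i)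
    ≡⟨ sym (∑-snoc (suc i) term) ⟩
  sum {suc (suc i)} (term ∘ toℕ) ∎
  where
  term : ℕ → ℕ
  term t = χ-even t * p t * c (j ∸ t)

T-recurrence : ∀ m n →
               T (suc n) (suc m) ≡ T (suc n) m + conv χ-even (λ j → T j m) (λ j → T j (suc m)) (suc n)
T-recurrence m n = begin
  head (colRev prev (suc n))
    ≡⟨ head-colRev-suc prev n ⟩
  prev (suc n) + evenConv prev (curᴰ prev n) n n
    ≡⟨ cong (prev (suc n) +_) (evenConv≡sum prev (curᴰ prev n) n n) ⟩
  prev (suc n) + conv χ-even prev (curᴰ prev n) (suc n)
    ≡⟨ cong (prev (suc n) +_) (conv-cong χ-even {prev} {prev} (suc n) (λ _ _ → refl)
                                 λ j j<1+n → curᴰ≡head-colRev prev n j (≤-pred j<1+n)) ⟩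
  prev (suc n) + conv χ-even prev (λ j → T j (suc m)) (suc n) ∎
  where
  prev : ℕ → ℕ
  prev i = T i m

conv-recurrence-unique : ∀ (w a b : ℕ → ℕ) {f g : ℕ → ℕ} → f 0 ≡ g 0 →
  (∀ n → f (suc n) ≡ a (suc n) + conv w b f (suc n)) →
  (∀ n → g (suc n) ≡ a (suc n) + conv w b g (suc n)) →
  ∀ n → f n ≡ g n
conv-recurrence-unique w a b {f} {g} f0≡g0 f-rec g-rec = <-rec _ step
  where
  step : ∀ n → (∀ {j} → j < n → f j ≡ g j) → f n ≡ g n
  step zero    _   = f0≡g0
  step (suc n) f≡g = begin
    f (suc n)
      ≡⟨ f-rec n ⟩
    a (suc n) + conv w b f (suc n)
      ≡⟨ cong (a (suc n) +_) (conv-cong w {b} {b} (suc n) (λ _ _ → refl) λ _ → f≡g) ⟩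
    a (suc n) + conv w b g (suc n)
      ≡⟨ sym (g-rec n) ⟩
    g (suc n) ∎

uA-one : ∀ n → uA 1 n 0 ≡ 1
uA-one zero    = refl
uA-one (suc n) = trans (+-identityʳ _) (uA-one n)

T≡uA : ∀ m n → T n m ≡ uA (suc m) n 0
T≡uA zero    n = sym (uA-one n)
T≡uA (suc m) = conv-recurrence-unique χ-even Tₘ Tₘ (T≡uA m 0) (T-recurrence m) R-recurrence
  where
  Tₘ R : ℕ → ℕ
  Tₘ j = T j m
  R r = uA (suc (suc m)) r 0

  R-recurrence : ∀ n → R (suc n) ≡ Tₘ (suc n) + conv χ-even Tₘ R (suc n)
  R-recurrence n = begin
    R (suc n)
      ≡⟨ uA-suc-recurrence (suc m) n z<s ⟩
    uA (suc m) (suc n) 0 + conv χ-even (λ j → uA (suc m) j 0) R (suc n)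
      ≡⟨ cong₂ _+_ (sym (T≡uA m (suc n)))
                   (conv-cong χ-even {g = R} (suc n) (λ j _ → sym (T≡uA m j)) λ _ _ → refl) ⟩
    Tₘ (suc n) + conv χ-even Tₘ R (suc n) ∎

theorem1p4 : (m n : ℕ) → T n m ≡ bil (u (suc m)) (A (suc m) ^M n) (v1 m)
theorem1p4 m n = begin
  T n m                                          ≡⟨ T≡uA m n ⟩
  uA (suc m) n 0                                 ≡⟨ sym (u-A^n (suc m) n zero) ⟩
  (u (suc m) ᵀ* (A (suc m) ^M n)) zero           ≡⟨ sym (bil-v1 (u (suc m)) (A (suc m) ^M n)) ⟩
  bil (u (suc m)) (A (suc m) ^M n) (v1 m)        ∎
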